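{- Let $B$ be a nontrivial atomless Boolean algebra and $2\le n\le\omega$. Then $\mathfrak p(B)\le\mathfrak i_n(B)$.
   Context: $\mathfrak p(B)=\min\{|Y|: Y\subseteq B,\ \sum Y=1,\ \sum Y'\neq1\text{ for every finite }Y'\subseteq Y\}$. For $1\le n<\omega$, $X\subseteq B$ is $n$-independent if $0\notin X$ and for all nonempty finite $F,G\subseteq X$: $\sum F\neq1$; if $\prod F=0$ then $\prod F'=0$ for some $F'\subseteq F$ with $|F'|\le n$; if $0\neq\prod F\le\sum G$ then $F\cap G\neq\emptyset$. $X$ is $\omega$-independent if $0\notin X$ and the first and third conditions hold. $\mathfrak i_n(B)$ is the minimum cardinality of a maximal (under inclusion) $n$-independent subset of $B$. -}

module Defs where

open import Level using (Level; _⊔_)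
open import Algebra.Lattice.Bundles using (BooleanAlgebra)
open import Data.Nat using (ℕ; _≤_)
open import Data.List using (List; []; foldr; length)
open import Data.List.Relation.Unary.All using (All)
open import Data.List.Relation.Unary.Any using (Any)
open import Data.List.Membership.Propositional using (_∈_)
open import Data.Product using (Σ; ∃; ∃-syntax; _×_; proj₁)
open import Relation.Nullary using (¬_)
open import Relation.Binary.PropositionalEquality using (_≢_)
open import Relation.Unary using (Pred)

data ℕω : Set where
  fin : ℕ → ℕω
  ω   : ℕω

TwoLe : ℕω → Set
TwoLe (fin k) = 2 ≤ k
TwoLe ω       = Data.Unit.⊤ where import Data.Unit

module BA {c ℓ : Level} (B : BooleanAlgebra c ℓ) where
  open BooleanAlgebra B renaming (¬_ to ∁_)

  Subset : Set _
  Subset = Pred Carrier (c ⊔ ℓ)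

  _⊆ₛ_ : Subset → Subset → Set _
  X ⊆ₛ Y = ∀ x → X x → Y x

  _≤B_ : Carrier → Carrier → Set ℓ
  x ≤B y = (x ∧ y) ≈ x

  Nontrivial : Set ℓ
  Nontrivial = ¬ (⊤ ≈ ⊥)

  Atomless : Set _
  Atomless = ∀ a → ¬ (a ≈ ⊥) → ∃[ b ] (b ≤B a × ¬ (b ≈ ⊥) × ¬ (b ≈ a))

  ⋁ : List Carrier → Carrier
  ⋁ = foldr _∨_ ⊥

  ⋀ : List Carrier → Carrier
  ⋀ = foldr _∧_ ⊤

  FinSub : Subset → List Carrier → Set _
  FinSub X F = All X F

  SumIsOne : Subset → Set _
  SumIsOne Y = (∀ y → Y y → y ≤B ⊤) × (∀ u → (∀ y → Y y → y ≤B u) → ⊤ ≤B u)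

  -- the sets whose minimal cardinality is 𝔭(B)
  PCandidate : Subset → Set _
  PCandidate Y = SumIsOne Y × (∀ F → FinSub Y F → ¬ (⋁ F ≈ ⊤))

  Meets : List Carrier → List Carrier → Set _
  Meets F G = ∃[ f ] ∃[ g ] (f ∈ F × g ∈ G × f ≈ g)

  Reduce : ℕ → Subset → Set _
  Reduce n X = ∀ F → F ≢ [] → FinSub X F → ⋀ F ≈ ⊥ →
               ∃[ F' ] (All (_∈ F) F' × length F' ≤ n × ⋀ F' ≈ ⊥)

  Independent : ℕω → Subset → Set _
  Independent n X =
    (∀ x → X x → ¬ (x ≈ ⊥)) ×
    (∀ F → F ≢ [] → FinSub X F → ¬ (⋁ F ≈ ⊤)) ×
    RedClause n ×
    (∀ F G → F ≢ [] → G ≢ [] → FinSub X F → FinSub X G →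
       ¬ (⋀ F ≈ ⊥) → ⋀ F ≤B ⋁ G → Meets F G)
    where
      RedClause : ℕω → Set _
      RedClause (fin k) = Reduce k X
      RedClause ω       = Level.Lift _ Data.Unit.⊤ where import Data.Unit

  MaximalIndependent : ℕω → Subset → Set _
  MaximalIndependent n X =
    Independent n X × (∀ Z → Independent n Z → X ⊆ₛ Z → Z ⊆ₛ X)

  -- |Y| ≤ |X|: an injection from (the elements of) Y into X
  _≼_ : Subset → Subset → Set _
  Y ≼ X = Σ (Σ Carrier Y → Σ Carrier X) λ f →
            ∀ a b → proj₁ (f a) ≈ proj₁ (f b) → proj₁ a ≈ proj₁ b

module Submission where

-- Idea: a maximal n-independent set X is itself a witness for 𝔭(B), so the
-- identity injection X ↪ X gives the inequality.  No finite subfamily of X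
-- has join 1 (for nonempty families this is part of independence, for the
-- empty family it is nontriviality), so what remains is ⋁ X = 1.  Suppose
-- u bounds X but ⊤ ≰ u (classically, this is the only other case).  Then
-- ∁ u ≠ 0, and atomlessness yields 0 ≠ z < ∁ u.  The "extension lemma"
-- shows that X ∪ {z} is again n-independent: z is disjoint from every
-- element of X, which makes every new meet containing both z and an
-- element of X vanish in two factors (hence n ≥ 2), while z < ∁ u keeps
-- u ∨ z ≠ 1.  Maximality of X then puts z in X, so z ≤ u ∧ ∁ u = 0.

open import Defs
open import Level using (Level; _⊔_)
open import Algebra.Lattice.Bundles using (BooleanAlgebra)
open import Axiom.ExcludedMiddle using (ExcludedMiddle)
open import Data.Product using (∃-syntax; _×_; _,_)
open import Data.Sum using (_⊎_; inj₁; inj₂)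
open import Data.Empty using (⊥-elim)
open import Data.Nat using (ℕ) renaming (_≤_ to _≤ℕ_)
open import Data.List using (List; []; _∷_)
open import Data.List.Relation.Unary.All as All using (All; []; _∷_)
open import Data.List.Relation.Unary.Any using (here; there)
open import Data.List.Membership.Propositional using (_∈_)
open import Relation.Binary.PropositionalEquality using (_≡_; _≢_; refl)
open import Relation.Nullary using (¬_; yes; no)
import Algebra.Lattice.Properties.BooleanAlgebra as BooleanAlgebraProperties
import Relation.Binary.Lattice.Bundles as OrderTheoretic
import Relation.Binary.Reasoning.Setoid as SetoidReasoning

module Development {c ℓ : Level} (B : BooleanAlgebra c ℓ) where
  open BooleanAlgebra B renaming (¬_ to ∁_; refl to ≈-refl)
  open BA B
  open BooleanAlgebraProperties B
    using (∧-identityʳ; ∧-identityˡ; ∧-zeroˡ; ∧-zeroʳ; ∨-identityˡ; ∨-identityʳ;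
           ∧-idem; ¬-involutive; ¬⊥≈⊤; ∨-∧-orderTheoreticLattice)
  open SetoidReasoning setoid

  -- The library orders B by  x ≈ x ∧ y ; the order  _≤B_  of the statement
  -- is the same relation with the equation flipped, so every order fact
  -- below is the library's one composed with  sym .
  private module L = OrderTheoretic.Lattice ∨-∧-orderTheoreticLattice

  ≤-trans : ∀ {x y z} → x ≤B y → y ≤B z → x ≤B z
  ≤-trans p q = sym (L.trans (sym p) (sym q))

  ∨-least : ∀ {x y w} → x ≤B w → y ≤B w → (x ∨ y) ≤B w
  ∨-least p q = sym (L.∨-least (sym p) (sym q))

  x≤x∨y : ∀ x y → x ≤B (x ∨ y)
  x≤x∨y x y = sym (L.x≤x∨y x y)

  y≤x∨y : ∀ x y → y ≤B (x ∨ y)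
  y≤x∨y x y = sym (L.y≤x∨y x y)

  ∧-greatest : ∀ {w x y} → w ≤B x → w ≤B y → w ≤B (x ∧ y)
  ∧-greatest p q = sym (L.∧-greatest (sym p) (sym q))

  x∧y≤x : ∀ x y → (x ∧ y) ≤B x
  x∧y≤x x y = sym (L.x∧y≤x x y)

  x∧y≤y : ∀ x y → (x ∧ y) ≤B y
  x∧y≤y x y = sym (L.x∧y≤y x y)

  x≤⊤ : ∀ x → x ≤B ⊤
  x≤⊤ = ∧-identityʳ

  ⊥≤x : ∀ x → ⊥ ≤B x
  ⊥≤x = ∧-zeroˡ

  x≤⊥⇒x≈⊥ : ∀ {x} → x ≤B ⊥ → x ≈ ⊥
  x≤⊥⇒x≈⊥ {x} p = trans (sym p) (∧-zeroʳ x)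

  ≤-≈⊥ : ∀ {x y} → x ≤B y → y ≈ ⊥ → x ≈ ⊥
  ≤-≈⊥ x≤y y≈⊥ = x≤⊥⇒x≈⊥ (trans (∧-cong ≈-refl (sym y≈⊥)) x≤y)

  disjoint : ∀ {x y u} → x ≤B u → y ≤B (∁ u) → (x ∧ y) ≈ ⊥
  disjoint {x} {y} {u} x≤u y≤∁u = ≤-≈⊥ x∧y≤u∧∁u (∧-complementʳ u)
    where
    x∧y≤u∧∁u : (x ∧ y) ≤B (u ∧ ∁ u)
    x∧y≤u∧∁u = ∧-greatest (≤-trans (x∧y≤x x y) x≤u) (≤-trans (x∧y≤y x y) y≤∁u)

  self-disjoint : ∀ {x} → (x ∧ x) ≈ ⊥ → x ≈ ⊥
  self-disjoint {x} e = trans (sym (∧-idem x)) e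

  ≤-∨-cancelʳ : ∀ {p a b} → p ≤B (a ∨ b) → (p ∧ b) ≈ ⊥ → p ≤B a
  ≤-∨-cancelʳ {p} {a} {b} p≤a∨b p∧b≈⊥ = sym (begin
    p                  ≈⟨ sym p≤a∨b ⟩
    p ∧ (a ∨ b)        ≈⟨ ∧-distribˡ-∨ p a b ⟩
    (p ∧ a) ∨ (p ∧ b)  ≈⟨ ∨-cong ≈-refl p∧b≈⊥ ⟩
    (p ∧ a) ∨ ⊥        ≈⟨ ∨-identityʳ _ ⟩
    p ∧ a              ∎)

  ⊤≰⇒∁≉⊥ : ∀ {u} → ¬ (⊤ ≤B u) → ¬ (∁ u ≈ ⊥)
  ⊤≰⇒∁≉⊥ {u} ⊤≰u ∁u≈⊥ = ⊤≰u (trans (∧-identityˡ u) u≈⊤)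
    where
    u≈⊤ : u ≈ ⊤
    u≈⊤ = trans (sym (¬-involutive u)) (trans (¬-cong ∁u≈⊥) ¬⊥≈⊤)

  cover⇒∁≈ : ∀ {u y} → ⊤ ≤B (u ∨ y) → y ≤B (∁ u) → ∁ u ≈ y
  cover⇒∁≈ {u} {y} ⊤≤u∨y y≤∁u = begin
    ∁ u                    ≈⟨ sym (∧-identityʳ _) ⟩
    ∁ u ∧ ⊤                ≈⟨ ∧-cong ≈-refl (trans (sym ⊤≤u∨y) (∧-identityˡ _)) ⟩
    ∁ u ∧ (u ∨ y)          ≈⟨ ∧-distribˡ-∨ _ _ _ ⟩
    (∁ u ∧ u) ∨ (∁ u ∧ y)  ≈⟨ ∨-cong (∧-complementˡ u) ≈-refl ⟩
    ⊥ ∨ (∁ u ∧ y)          ≈⟨ ∨-identityˡ _ ⟩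
    ∁ u ∧ y                ≈⟨ ∧-comm _ _ ⟩
    y ∧ ∁ u                ≈⟨ y≤∁u ⟩
    y                      ∎

  ⋁-least : ∀ {w} F → All (_≤B w) F → ⋁ F ≤B w
  ⋁-least []      []         = ⊥≤x _
  ⋁-least (_ ∷ F) (p ∷ ps)   = ∨-least p (⋁-least F ps)

  ∈⇒⋀≤ : ∀ {x} F → x ∈ F → ⋀ F ≤B x
  ∈⇒⋀≤ (y ∷ F) (here refl) = x∧y≤x y (⋀ F)
  ∈⇒⋀≤ (y ∷ F) (there x∈F) = ≤-trans (x∧y≤y y (⋀ F)) (∈⇒⋀≤ F x∈F)

  Separating : Subset → Set (c ⊔ ℓ)
  Separating X = ∀ F G → F ≢ [] → G ≢ [] → FinSub X F → FinSub X G →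
                 ¬ (⋀ F ≈ ⊥) → ⋀ F ≤B ⋁ G → Meets F G

  module Extension (X : Subset) (u : Carrier) (bound : ∀ x → X x → x ≤B u)
                   (z : Carrier) (z≤∁u : z ≤B (∁ u))
                   (z≉⊥ : ¬ (z ≈ ⊥)) (z≉∁u : ¬ (z ≈ ∁ u)) where

    Z : Subset
    Z y = X y ⊎ y ≡ z

    -- z is disjoint from everything below u, so it is not below u itself.
    z≰u : ¬ (z ≤B u)
    z≰u z≤u = z≉⊥ (self-disjoint (disjoint z≤u z≤∁u))

    inX-or-∋z : ∀ F → All Z F → All X F ⊎ z ∈ F
    inX-or-∋z []      []                = inj₁ []
    inX-or-∋z (_ ∷ _) (inj₂ refl ∷ _)   = inj₂ (here refl)
    inX-or-∋z (_ ∷ F) (inj₁ x ∷ ps) with inX-or-∋z F ps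
    ... | inj₁ F⊆X = inj₁ (x ∷ F⊆X)
    ... | inj₂ z∈F = inj₂ (there z∈F)

    meetsX-or-z≤⋀ : ∀ F → All Z F → (∃[ x ] (x ∈ F × X x)) ⊎ z ≤B ⋀ F
    meetsX-or-z≤⋀ []      []              = inj₂ (x≤⊤ z)
    meetsX-or-z≤⋀ (y ∷ _) (inj₁ x ∷ _)    = inj₁ (y , here refl , x)
    meetsX-or-z≤⋀ (_ ∷ F) (inj₂ refl ∷ ps) with meetsX-or-z≤⋀ F ps
    ... | inj₁ (x , x∈F , Xx) = inj₁ (x , there x∈F , Xx)
    ... | inj₂ z≤⋀F           = inj₂ (∧-greatest (∧-idem z) z≤⋀F)

    X-part : ∀ G → All Z G →
             ∃[ G' ] (All X G' × All (_∈ G) G' × ⋁ G ≤B (⋁ G' ∨ z))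
    X-part [] [] = [] , [] , [] , ⊥≤x _
    X-part (g ∷ G) (inj₁ Xg ∷ ps) with X-part G ps
    ... | G' , G'⊆X , G'⊆G , ⋁G≤ =
      g ∷ G' , Xg ∷ G'⊆X , here refl ∷ All.map there G'⊆G ,
      ∨-least (≤-trans (x≤x∨y g _) (x≤x∨y _ z))
              (≤-trans ⋁G≤ (∨-least (≤-trans (y≤x∨y g _) (x≤x∨y _ z)) (y≤x∨y _ z)))
    X-part (_ ∷ G) (inj₂ refl ∷ ps) with X-part G ps
    ... | G' , G'⊆X , G'⊆G , ⋁G≤ =
      G' , G'⊆X , All.map there G'⊆G , ∨-least (y≤x∨y _ z) ⋁G≤

    nonzero : (∀ x → X x → ¬ (x ≈ ⊥)) → ∀ y → Z y → ¬ (y ≈ ⊥)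
    nonzero X-nonzero y (inj₁ Xy) = X-nonzero y Xy
    nonzero X-nonzero _ (inj₂ refl) = z≉⊥

    -- Every join from Z lies below u ∨ z, which is not 1 since z ≠ ∁ u.
    noFiniteCover : ∀ F → F ≢ [] → FinSub Z F → ¬ (⋁ F ≈ ⊤)
    noFiniteCover F _ F⊆Z ⋁F≈⊤ = z≉∁u (sym (cover⇒∁≈ ⊤≤u∨z z≤∁u))
      where
      below-u∨z : ∀ y → Z y → y ≤B (u ∨ z)
      below-u∨z y (inj₁ Xy)   = ≤-trans (bound y Xy) (x≤x∨y u z)
      below-u∨z _ (inj₂ refl) = y≤x∨y u z
      ⊤≤u∨z : ⊤ ≤B (u ∨ z)
      ⊤≤u∨z = trans (∧-cong (sym ⋁F≈⊤) ≈-refl)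
                    (trans (⋁-least F (All.map (λ {y} → below-u∨z y) F⊆Z)) ⋁F≈⊤)

    -- A new vanishing meet always has a vanishing subfamily {x , z}.
    reduce : (k : ℕ) → 2 ≤ℕ k → Reduce k X → Reduce k Z
    reduce k 2≤k X-reduce F F≢[] F⊆Z ⋀F≈⊥ with inX-or-∋z F F⊆Z
    ... | inj₁ F⊆X = X-reduce F F≢[] F⊆X ⋀F≈⊥
    ... | inj₂ z∈F with meetsX-or-z≤⋀ F F⊆Z
    ...   | inj₂ z≤⋀F = ⊥-elim (z≉⊥ (≤-≈⊥ z≤⋀F ⋀F≈⊥))
    ...   | inj₁ (x , x∈F , Xx) =
      x ∷ z ∷ [] , x∈F ∷ z∈F ∷ [] , 2≤k ,
      trans (∧-cong ≈-refl (∧-identityʳ z)) (disjoint (bound x Xx) z≤∁u)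

    -- Separation when F ⊆ X: since ⋀ F ≤ f ≤ u is disjoint from z, the
    -- copies of z in G can be dropped and the separation of X applies.
    separating-inX : Separating X → ∀ F G → F ≢ [] → All X F → All Z G →
                     ¬ (⋀ F ≈ ⊥) → ⋀ F ≤B ⋁ G → Meets F G
    separating-inX _ [] _ F≢[] _ _ _ _ = ⊥-elim (F≢[] refl)
    separating-inX X-sep (f ∷ F) G _ (Xf ∷ F⊆X) G⊆Z ⋀F≉⊥ ⋀F≤⋁G with X-part G G⊆Z
    ... | G' , G'⊆X , G'⊆G , ⋁G≤ =
      restrict G' G'⊆X G'⊆G (≤-∨-cancelʳ (≤-trans ⋀F≤⋁G ⋁G≤) ⋀F∧z≈⊥)
      where
      ⋀F∧z≈⊥ : (⋀ (f ∷ F) ∧ z) ≈ ⊥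
      ⋀F∧z≈⊥ = disjoint (≤-trans (x∧y≤x f (⋀ F)) (bound f Xf)) z≤∁u
      restrict : ∀ G' → All X G' → All (_∈ G) G' → ⋀ (f ∷ F) ≤B ⋁ G' → Meets (f ∷ F) G
      restrict [] _ _ ⋀F≤⊥ = ⊥-elim (⋀F≉⊥ (x≤⊥⇒x≈⊥ ⋀F≤⊥))
      restrict (g ∷ G') G'⊆X G'⊆G ⋀F≤⋁G'
        with X-sep (f ∷ F) (g ∷ G') (λ ()) (λ ()) (Xf ∷ F⊆X) G'⊆X ⋀F≉⊥ ⋀F≤⋁G'
      ... | a , b , a∈F , b∈G' , a≈b = a , b , a∈F , All.lookup G'⊆G b∈G' , a≈b

    -- Separation in general: a family containing z has a nonzero meet only
    -- if it consists of copies of z, and then G must contain z as well.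
    separating : Separating X → Separating Z
    separating X-sep F G F≢[] _ F⊆Z G⊆Z ⋀F≉⊥ ⋀F≤⋁G with inX-or-∋z F F⊆Z
    ... | inj₁ F⊆X = separating-inX X-sep F G F≢[] F⊆X G⊆Z ⋀F≉⊥ ⋀F≤⋁G
    ... | inj₂ z∈F with meetsX-or-z≤⋀ F F⊆Z
    ...   | inj₁ (x , x∈F , Xx) =
      ⊥-elim (⋀F≉⊥ (≤-≈⊥ (∧-greatest (∈⇒⋀≤ F x∈F) (∈⇒⋀≤ F z∈F))
                         (disjoint (bound x Xx) z≤∁u)))
    ...   | inj₂ z≤⋀F with inX-or-∋z G G⊆Z
    ...     | inj₂ z∈G = z , z , z∈F , z∈G , ≈-refl
    ...     | inj₁ G⊆X = ⊥-elim (z≰u (≤-trans (≤-trans z≤⋀F ⋀F≤⋁G)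
                                             (⋁-least G (All.map (λ {x} → bound x) G⊆X))))

    independent : (n : ℕω) → TwoLe n → Independent n X → Independent n Z
    independent (fin k) 2≤k (X-nonzero , _ , X-reduce , X-sep) =
      nonzero X-nonzero , noFiniteCover , reduce k 2≤k X-reduce , separating X-sep
    independent ω _ (X-nonzero , _ , trivial , X-sep) =
      nonzero X-nonzero , noFiniteCover , trivial , separating X-sep

  -- A maximal n-independent set has join 1 (B atomless, 2 ≤ n ≤ ω): an
  -- upper bound u with ⊤ ≰ u would leave room below ∁ u for a new element.
  maximal⇒sumIsOne : ExcludedMiddle ℓ → Atomless → (n : ℕω) → TwoLe n →
                     ∀ X → MaximalIndependent n X → SumIsOne X
  maximal⇒sumIsOne lem atomless n 2≤n X (X-indep , X-maximal) =
    (λ y _ → x≤⊤ y) , onlyTopBounds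
    where
    onlyTopBounds : ∀ u → (∀ x → X x → x ≤B u) → ⊤ ≤B u
    onlyTopBounds u bound with lem {⊤ ≤B u}
    ... | yes ⊤≤u = ⊤≤u
    ... | no ⊤≰u with atomless (∁ u) (⊤≰⇒∁≉⊥ ⊤≰u)
    ...   | z , z≤∁u , z≉⊥ , z≉∁u = ⊥-elim (z≰u (bound z Xz))
      where
      open Extension X u bound z z≤∁u z≉⊥ z≉∁u
      Xz : X z
      Xz = X-maximal Z (independent n 2≤n X-indep) (λ _ → inj₁) z (inj₂ refl)

  independent⇒noFiniteCover : Nontrivial → ∀ n X → Independent n X →
                              ∀ F → FinSub X F → ¬ (⋁ F ≈ ⊤)
  independent⇒noFiniteCover nontrivial _ _ _ []      _    ⊥≈⊤ = nontrivial (sym ⊥≈⊤)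
  independent⇒noFiniteCover _ _ _ (_ , noCover , _) (x ∷ F) F⊆X =
    noCover (x ∷ F) (λ ()) F⊆X

  ≼-refl : ∀ X → X ≼ X
  ≼-refl X = (λ a → a) , (λ _ _ e → e)

mainTheorem7 : (lem : ∀ {a : Level} → ExcludedMiddle a) →
               {c ℓ : Level} (B : BooleanAlgebra c ℓ) →
               BA.Nontrivial B → BA.Atomless B →
               (n : ℕω) → TwoLe n →
               (X : BA.Subset B) → BA.MaximalIndependent B n X →
               ∃[ Y ] (BA.PCandidate B Y × BA._≼_ B Y X)
mainTheorem7 lem B nontrivial atomless n 2≤n X X-maximal@(X-indep , _) =
  X , (maximal⇒sumIsOne lem atomless n 2≤n X X-maximal ,
       independent⇒noFiniteCover nontrivial n X X-indep) ,
  ≼-refl X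
  where open Development B
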